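{- For all integers $n,N$ with $0\leq n\leq N$, the following identities hold in $\mathfrak{H}=\mathbb{Q}\langle x,y\rangle$: \[ z_2^n \,\mathrm{sh}\, z_2^N=\sum_{k=0}^{n}4^k\binom{N+n-2k}{n-k}\left\{z_2^{N+n-2k}\,\widetilde{\mathrm{sh}}\,(z_3z_1)^k\right\}, \] \[ z_1z_2^n \,\mathrm{sh}\, z_1z_2^N=2\sum_{k=0}^{n}4^k\binom{N+n-2k}{n-k}\, z_1\left\{z_2^{N+n-2k}\,\widetilde{\mathrm{sh}}\, z_1(z_3z_1)^k\right\}. \]
   Context: Let $\mathfrak{H}=\mathbb{Q}\langle x,y\rangle$ be the noncommutative polynomial ring in two indeterminates over $\mathbb{Q}$, with concatenation as multiplication. For $k\geq 1$ put $z_k=x^{k-1}y$. The $z_k$ generate freely the subring $\mathbb{Q}\langle z_1,z_2,\ldots\rangle=\mathbb{Q}+\mathfrak{H}y$. Powers such as $z_2^j$ and $(z_3z_1)^k$ are concatenation powers, with $w^0=1$. Juxtaposition, as in $z_1\{\cdots\}$, denotes concatenation product. The shuffle product $\mathrm{sh}$ on $\mathfrak{H}$ is the $\mathbb{Q}$-bilinear product defined inductively on words by $1\,\mathrm{sh}\,w=w\,\mathrm{sh}\,1=w$ and \[u_1w_1\,\mathrm{sh}\,u_2w_2=u_1(w_1\,\mathrm{sh}\,u_2w_2)+u_2(u_1w_1\,\mathrm{sh}\,w_2)\] for letters $u_1,u_2\in\{x,y\}$ and words $w,w_1,w_2$. The product $\widetilde{\mathrm{sh}}$ on $\mathbb{Q}\langle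 z_1,z_2,\ldots\rangle$ is the $\mathbb{Q}$-bilinear product defined inductively by the same rules, but with letters $u_1,u_2\in\{z_k\}_{k\geq1}$ and words $w,w_1,w_2$ in the $z_k$. For example, $z_m\,\widetilde{\mathrm{sh}}\,z_nz_l=z_mz_nz_l+z_nz_mz_l+z_nz_lz_m$. -}

module Defs where

open import Data.Nat using (ℕ; zero; suc; _∸_)
open import Data.Integer using (+_)
open import Data.Rational using (ℚ; 0ℚ; 1ℚ; _/_; _*_; _+_)
open import Data.List using (List; []; _∷_; _++_; map; concat; concatMap; replicate; upTo)
open import Data.List.Properties using (≡-dec)
open import Data.Product using (_×_; _,_)
open import Relation.Binary.PropositionalEquality using (_≡_; refl)
open import Relation.Nullary using (Dec; yes; no)

data Letter : Set where
  x y : Letter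

_≟L_ : (a b : Letter) → Dec (a ≡ b)
x ≟L x = yes refl
x ≟L y = no (λ ())
y ≟L x = no (λ ())
y ≟L y = yes refl

Word : Set
Word = List Letter

_≟W_ : (u v : Word) → Dec (u ≡ v)
_≟W_ = ≡-dec _≟L_

Poly : Set
Poly = List (ℚ × Word)

coeff : Poly → Word → ℚ
coeff [] w = 0ℚ
coeff ((c , u) ∷ p) w with u ≟W w
... | yes _ = c + coeff p w
... | no  _ = coeff p w

infix 4 _≈_
_≈_ : Poly → Poly → Set
p ≈ q = ∀ w → coeff p w ≡ coeff q w

infixl 6 _⊕_
_⊕_ : Poly → Poly → Poly
_⊕_ = _++_

ℕ→ℚ : ℕ → ℚ
ℕ→ℚ n = (+ n) / 1

_·_ : ℚ → Poly → Poly
c · p = map (λ { (d , w) → (c * d , w) }) p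

_◃_ : Word → Poly → Poly
u ◃ p = map (λ { (d , w) → (d , u ++ w) }) p

Σ≤ : ℕ → (ℕ → Poly) → Poly
Σ≤ n f = concat (map f (upTo (suc n)))

shuffles : {A : Set} → List A → List A → List (List A)
shuffles [] v = v ∷ []
shuffles (a ∷ u) [] = (a ∷ u) ∷ []
shuffles (a ∷ u) (b ∷ v) =
  map (a ∷_) (shuffles u (b ∷ v)) ++ map (b ∷_) (shuffles (a ∷ u) v)

_sh_ : Poly → Poly → Poly
p sh q = concatMap (λ { (c , u) → concatMap (λ { (d , v) →
           map (λ w → (c * d , w)) (shuffles u v) }) q }) p

z : ℕ → Word
z k = replicate (k ∸ 1) x ++ (y ∷ [])

-- words in the letters z_k, written as lists of indices k ≥ 1
ZWord : Set
ZWord = List ℕ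

toWord : ZWord → Word
toWord = concatMap z

-- the product sh~ on words in the z_k (letters z_k treated as atomic), viewed in 𝔥
_shz_ : ZWord → ZWord → Poly
u shz v = map (λ w → (1ℚ , toWord w)) (shuffles u v)

pow : {A : Set} → List A → ℕ → List A
pow w zero = []
pow w (suc n) = w ++ pow w n

⟦_⟧ : Word → Poly
⟦ w ⟧ = (1ℚ , w) ∷ []

module Submission where

-- Both identities are compared coefficientwise, coefficients being counted in ℕ.
-- Let p a b and d a b be the coefficient families of  z₂^a sh z₂^b  and
-- z₂^a sh z₁z₂^b + z₁z₂^a sh z₂^b ;  note that z₁z₂^a sh z₁z₂^b = y (d a b).
-- The shuffle recursion, read on the first letters of a word w, shows that (p, d)
-- satisfies a recursion in w (stepP, stepD): a leading z₂ = xy lowers a or b, a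
-- leading z₃ = xxy lowers both and passes from p to d, a leading z₁ = y passes from
-- d back to p.  This recursion has at most one solution (solution-unique).
-- The coefficient families of the proposed right-hand sides
--   Σ_k 4^k C(a+b−2k, a−k) (z₂^{a+b−2k} sh~ (z₃z₁)^k),  2 Σ_k ⋯ (z₂^{a+b−2k} sh~ z₁(z₃z₁)^k)
-- satisfy it as well, by the shuffle recursion for sh~ and Pascal's rule for the
-- coefficients.

open import Defs
open import Data.Nat using (ℕ; zero; suc; _≤_; _<_; _+_; _∸_; _^_; _*_; s≤s; z≤n)
open import Data.Nat.Properties
  using (+-identityʳ; +-assoc; +-suc; *-zeroʳ; *-assoc; *-distribˡ-+; *-distribʳ-+; ≤-pred; ≤-trans; +-commutativeSemigroup)
open import Data.Nat.Combinatorics using (_C_; nCn≡1; nCk+nC[k+1]≡[n+1]C[k+1])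
open import Data.List using (List; []; _∷_; _++_; map; concat; applyUpTo; replicate)
open import Data.List.Properties using (map-++; map-∘; map-id; ++-identityʳ)
open import Data.Product using (_×_; _,_; proj₁; proj₂)
open import Data.Bool using (if_then_else_)
open import Relation.Nullary using (does; yes; no)
open import Relation.Binary.PropositionalEquality using (_≡_; refl; sym; trans; cong; cong₂; module ≡-Reasoning)
open import Algebra.Properties.CommutativeSemigroup +-commutativeSemigroup using (interchange)
import Data.Integer as ℤ
import Data.Integer.Properties as ℤP
import Data.Rational as ℚ
import Data.Rational.Properties as ℚP
import Data.Rational.Unnormalised as ℚᵘ
import Data.Rational.Unnormalised.Properties as ℚᵘP

open ≡-Reasoning

ind : Word → Word → ℕ
ind u w = if does (u ≟W w) then 1 else 0

occ : Word → List Word → ℕ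
occ w [] = 0
occ w (u ∷ L) = ind u w + occ w L

occ-++ : ∀ w L₁ L₂ → occ w (L₁ ++ L₂) ≡ occ w L₁ + occ w L₂
occ-++ w [] L₂ = refl
occ-++ w (u ∷ L₁) L₂ = trans (cong (ind u w +_) (occ-++ w L₁ L₂)) (sym (+-assoc (ind u w) _ _))

occ-map-∷ : ∀ a c w L → occ (c ∷ w) (map (a ∷_) L) ≡ (if does (a ≟L c) then occ w L else 0)
occ-map-∷ a c w [] with a ≟L c
... | yes _ = refl
... | no _ = refl
occ-map-∷ x x w (s ∷ L) = cong (ind s w +_) (occ-map-∷ x x w L)
occ-map-∷ x y w (s ∷ L) = occ-map-∷ x y w L
occ-map-∷ y x w (s ∷ L) = occ-map-∷ y x w L
occ-map-∷ y y w (s ∷ L) = cong (ind s w +_) (occ-map-∷ y y w L)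

F : Word → Word → Word → ℕ
F u v w = occ w (shuffles u v)

F-right-empty : ∀ u w → F u [] w ≡ ind u w + 0
F-right-empty [] w = refl
F-right-empty (a ∷ u) w = refl

onTail : Word → Letter → (Word → ℕ) → ℕ
onTail [] c k = 0
onTail (a ∷ u) c k = if does (a ≟L c) then k u else 0

-- The shuffle recursion, read on coefficients: a shuffle of u and v begins with the
-- first letter of u or with the first letter of v.
F-step : ∀ u v c w → F u v (c ∷ w) ≡ onTail u c (λ u′ → F u′ v w) + onTail v c (λ v′ → F u v′ w)
F-step [] [] c w = refl
F-step [] (x ∷ v) x w = refl
F-step [] (x ∷ v) y w = refl
F-step [] (y ∷ v) x w = refl
F-step [] (y ∷ v) y w = refl
F-step (x ∷ u) [] x w = sym (trans (+-identityʳ _) (F-right-empty u w))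
F-step (x ∷ u) [] y w = refl
F-step (y ∷ u) [] x w = refl
F-step (y ∷ u) [] y w = sym (trans (+-identityʳ _) (F-right-empty u w))
F-step (a ∷ u) (b ∷ v) c w = begin
  occ (c ∷ w) (map (a ∷_) (shuffles u (b ∷ v)) ++ map (b ∷_) (shuffles (a ∷ u) v))
    ≡⟨ occ-++ (c ∷ w) (map (a ∷_) (shuffles u (b ∷ v))) (map (b ∷_) (shuffles (a ∷ u) v)) ⟩
  occ (c ∷ w) (map (a ∷_) (shuffles u (b ∷ v))) + occ (c ∷ w) (map (b ∷_) (shuffles (a ∷ u) v))
    ≡⟨ cong₂ _+_ (occ-map-∷ a c w (shuffles u (b ∷ v))) (occ-map-∷ b c w (shuffles (a ∷ u) v)) ⟩
  onTail (a ∷ u) c (λ u′ → F u′ (b ∷ v) w) + onTail (b ∷ v) c (λ v′ → F (a ∷ u) v′ w) ∎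

F-nil-left : ∀ a u v → F (a ∷ u) v [] ≡ 0
F-nil-left a u [] = refl
F-nil-left a u (b ∷ v) = trans (occ-++ [] (map (a ∷_) (shuffles u (b ∷ v))) (map (b ∷_) (shuffles (a ∷ u) v)))
  (cong₂ _+_ (no-empty a (shuffles u (b ∷ v))) (no-empty b (shuffles (a ∷ u) v)))
  where
  no-empty : ∀ c L → occ [] (map (c ∷_) L) ≡ 0
  no-empty c [] = refl
  no-empty c (s ∷ L) = no-empty c L

F-nil-right : ∀ u b v → F u (b ∷ v) [] ≡ 0
F-nil-right [] b v = refl
F-nil-right (a ∷ u) b v = F-nil-left a u (b ∷ v)

afterXY : ℕ → Word → (Word → ℕ) → ℕ
afterXY zero (y ∷ w) f = f w
afterXY (suc n) (x ∷ w) f = afterXY n w f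
afterXY _ _ f = 0

afterXY-+ : ∀ n w (f g : Word → ℕ) → afterXY n w (λ w′ → f w′ + g w′) ≡ afterXY n w f + afterXY n w g
afterXY-+ zero [] f g = refl
afterXY-+ zero (x ∷ w) f g = refl
afterXY-+ zero (y ∷ w) f g = refl
afterXY-+ (suc n) [] f g = refl
afterXY-+ (suc n) (x ∷ w) f g = afterXY-+ n w f g
afterXY-+ (suc n) (y ∷ w) f g = refl

afterXY-0 : ∀ n w → afterXY n w (λ _ → 0) ≡ 0
afterXY-0 zero [] = refl
afterXY-0 zero (x ∷ w) = refl
afterXY-0 zero (y ∷ w) = refl
afterXY-0 (suc n) [] = refl
afterXY-0 (suc n) (x ∷ w) = afterXY-0 n w
afterXY-0 (suc n) (y ∷ w) = refl

ind-xy-prefix : ∀ n t w → ind ((replicate n x ++ y ∷ []) ++ t) w ≡ afterXY n w (ind t)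
ind-xy-prefix zero t [] = refl
ind-xy-prefix zero t (x ∷ w) = refl
ind-xy-prefix zero t (y ∷ w) = refl
ind-xy-prefix (suc n) t [] = refl
ind-xy-prefix (suc n) t (x ∷ w) = ind-xy-prefix n t w
ind-xy-prefix (suc n) t (y ∷ w) = refl

occ-map-z∷ : ∀ a w L → occ w (map (λ s → toWord (a ∷ s)) L) ≡ afterXY (a ∸ 1) w (λ w′ → occ w′ (map toWord L))
occ-map-z∷ a w [] = sym (afterXY-0 (a ∸ 1) w)
occ-map-z∷ a w (s ∷ L) = begin
  ind (toWord (a ∷ s)) w + occ w (map (λ s → toWord (a ∷ s)) L)
    ≡⟨ cong₂ _+_ (ind-xy-prefix (a ∸ 1) (toWord s) w) (occ-map-z∷ a w L) ⟩
  afterXY (a ∸ 1) w (ind (toWord s)) + afterXY (a ∸ 1) w (λ w′ → occ w′ (map toWord L))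
    ≡⟨ afterXY-+ (a ∸ 1) w (ind (toWord s)) (λ w′ → occ w′ (map toWord L)) ⟨
  afterXY (a ∸ 1) w (λ w′ → occ w′ (map toWord (s ∷ L))) ∎

G : ZWord → ZWord → Word → ℕ
G u v w = occ w (map toWord (shuffles u v))

G-step : ∀ a u b v w → G (a ∷ u) (b ∷ v) w ≡ afterXY (a ∸ 1) w (G u (b ∷ v)) + afterXY (b ∸ 1) w (G (a ∷ u) v)
G-step a u b v w = begin
  occ w (map toWord (map (a ∷_) S₁ ++ map (b ∷_) S₂))
    ≡⟨ cong (occ w) (map-++ toWord (map (a ∷_) S₁) (map (b ∷_) S₂)) ⟩
  occ w (map toWord (map (a ∷_) S₁) ++ map toWord (map (b ∷_) S₂))
    ≡⟨ occ-++ w (map toWord (map (a ∷_) S₁)) (map toWord (map (b ∷_) S₂)) ⟩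
  occ w (map toWord (map (a ∷_) S₁)) + occ w (map toWord (map (b ∷_) S₂))
    ≡⟨ cong₂ _+_ (cong (occ w) (map-∘ S₁)) (cong (occ w) (map-∘ S₂)) ⟨
  occ w (map (λ s → toWord (a ∷ s)) S₁) + occ w (map (λ s → toWord (b ∷ s)) S₂)
    ≡⟨ cong₂ _+_ (occ-map-z∷ a w S₁) (occ-map-z∷ b w S₂) ⟩
  afterXY (a ∸ 1) w (G u (b ∷ v)) + afterXY (b ∸ 1) w (G (a ∷ u) v) ∎
  where
  S₁ = shuffles u (b ∷ v)
  S₂ = shuffles (a ∷ u) v

G-right-empty : ∀ u w → G u [] w ≡ ind (toWord u) w + 0
G-right-empty [] w = refl
G-right-empty (a ∷ u) w = refl

atPred : ℕ → (ℕ → ℕ) → ℕ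
atPred zero h = 0
atPred (suc a) h = h a

atPred-cong : ∀ a {f g : ℕ → ℕ} → (∀ a′ → f a′ ≡ g a′) → atPred a f ≡ atPred a g
atPred-cong zero e = refl
atPred-cong (suc a) e = e a

atPred-0 : ∀ a {f : ℕ → ℕ} → (∀ a′ → f a′ ≡ 0) → atPred a f ≡ 0
atPred-0 zero e = refl
atPred-0 (suc a) e = e a

atPred-swap : ∀ a b (f : ℕ → ℕ → ℕ) → atPred a (λ a′ → atPred b (f a′)) ≡ atPred b (λ b′ → atPred a (λ a′ → f a′ b′))
atPred-swap zero zero f = refl
atPred-swap zero (suc b) f = refl
atPred-swap (suc a) zero f = refl
atPred-swap (suc a) (suc b) f = refl

atPred-scale : ∀ c a (h : ℕ → ℕ) → c * atPred a h ≡ atPred a (λ a′ → c * h a′)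
atPred-scale c zero h = *-zeroʳ c
atPred-scale c (suc a) h = refl

bothZero : ℕ → ℕ → ℕ
bothZero a (suc b) = 0
bothZero zero zero = 1
bothZero (suc a) zero = 0

Family : Set
Family = ℕ → ℕ → Word → ℕ

-- The recursion in w satisfied by the coefficients p a b w of  z₂^a sh z₂^b  and
-- d a b w of  z₂^a sh z₁z₂^b + z₁z₂^a sh z₂^b :  a nonzero coefficient needs w to begin
-- with z₂ = xy or z₃ = xxy (for p), resp. with z₁ = y or z₂ (for d).
stepP : Family → Family → Family
stepP p d a b [] = bothZero a b
stepP p d a b (y ∷ w) = 0
stepP p d a b (x ∷ []) = 0
stepP p d a b (x ∷ y ∷ w) = atPred a (λ a′ → p a′ b w) + atPred b (λ b′ → p a b′ w)
stepP p d a b (x ∷ x ∷ []) = 0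
stepP p d a b (x ∷ x ∷ y ∷ w) = 2 * atPred a (λ a′ → atPred b (λ b′ → d a′ b′ w))
stepP p d a b (x ∷ x ∷ x ∷ w) = 0

stepD : Family → Family → Family
stepD p d a b [] = 0
stepD p d a b (y ∷ w) = 2 * p a b w
stepD p d a b (x ∷ []) = 0
stepD p d a b (x ∷ y ∷ w) = atPred a (λ a′ → d a′ b w) + atPred b (λ b′ → d a b′ w)
stepD p d a b (x ∷ x ∷ w) = 0

Solves : Family → Family → Set
Solves p d = ∀ a b w → p a b w ≡ stepP p d a b w × d a b w ≡ stepD p d a b w

-- The recursion determines its solution: the right-hand sides only use shorter words.
solution-unique : ∀ {p d p′ d′} → Solves p d → Solves p′ d′ →
                  ∀ w a b → p a b w ≡ p′ a b w × d a b w ≡ d′ a b w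
solution-unique {p} {d} {p′} {d′} sol sol′ = agree
  where
  agree : ∀ w a b → p a b w ≡ p′ a b w × d a b w ≡ d′ a b w
  steps-agree : ∀ w a b → stepP p d a b w ≡ stepP p′ d′ a b w × stepD p d a b w ≡ stepD p′ d′ a b w

  agree w a b =
    trans (proj₁ (sol a b w)) (trans (proj₁ (steps-agree w a b)) (sym (proj₁ (sol′ a b w)))) ,
    trans (proj₂ (sol a b w)) (trans (proj₂ (steps-agree w a b)) (sym (proj₂ (sol′ a b w))))

  steps-agree [] a b = refl , refl
  steps-agree (y ∷ w) a b = refl , cong (2 *_) (proj₁ (agree w a b))
  steps-agree (x ∷ []) a b = refl , refl
  steps-agree (x ∷ y ∷ w) a b =
    cong₂ _+_ (atPred-cong a (λ a′ → proj₁ (agree w a′ b))) (atPred-cong b (λ b′ → proj₁ (agree w a b′))) ,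
    cong₂ _+_ (atPred-cong a (λ a′ → proj₂ (agree w a′ b))) (atPred-cong b (λ b′ → proj₂ (agree w a b′)))
  steps-agree (x ∷ x ∷ []) a b = refl , refl
  steps-agree (x ∷ x ∷ y ∷ w) a b =
    cong (2 *_) (atPred-cong a (λ a′ → atPred-cong b (λ b′ → proj₂ (agree w a′ b′)))) , refl
  steps-agree (x ∷ x ∷ x ∷ w) a b = refl , refl

X : ℕ → Word
X a = pow (z 2) a

Y : ℕ → Word
Y a = y ∷ X a

lhsP : Family
lhsP a b w = F (X a) (X b) w

lhsD : Family
lhsD a b w = F (X a) (Y b) w + F (Y a) (X b) w

onTail-X-x : ∀ a k → onTail (X a) x k ≡ atPred a (λ a′ → k (Y a′))
onTail-X-x zero k = refl
onTail-X-x (suc a) k = refl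

onTail-X-y : ∀ a k → onTail (X a) y k ≡ 0
onTail-X-y zero k = refl
onTail-X-y (suc a) k = refl

F-XX-x : ∀ a b w → F (X a) (X b) (x ∷ w) ≡ atPred a (λ a′ → F (Y a′) (X b) w) + atPred b (λ b′ → F (X a) (Y b′) w)
F-XX-x a b w = trans (F-step (X a) (X b) x w) (cong₂ _+_ (onTail-X-x a _) (onTail-X-x b _))

F-XX-y : ∀ a b w → F (X a) (X b) (y ∷ w) ≡ 0
F-XX-y a b w = trans (F-step (X a) (X b) y w) (cong₂ _+_ (onTail-X-y a _) (onTail-X-y b _))

F-XY-x : ∀ a b w → F (X a) (Y b) (x ∷ w) ≡ atPred a (λ a′ → F (Y a′) (Y b) w)
F-XY-x a b w = trans (F-step (X a) (Y b) x w) (trans (+-identityʳ _) (onTail-X-x a _))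

F-XY-y : ∀ a b w → F (X a) (Y b) (y ∷ w) ≡ F (X a) (X b) w
F-XY-y a b w = trans (F-step (X a) (Y b) y w) (cong (_+ F (X a) (X b) w) (onTail-X-y a _))

F-YX-x : ∀ a b w → F (Y a) (X b) (x ∷ w) ≡ atPred b (λ b′ → F (Y a) (Y b′) w)
F-YX-x a b w = trans (F-step (Y a) (X b) x w) (onTail-X-x b _)

F-YX-y : ∀ a b w → F (Y a) (X b) (y ∷ w) ≡ F (X a) (X b) w
F-YX-y a b w = trans (F-step (Y a) (X b) y w) (trans (cong (F (X a) (X b) w +_) (onTail-X-y b _)) (+-identityʳ _))

F-YY-nil : ∀ a b → F (Y a) (Y b) [] ≡ 0
F-YY-nil a b = F-nil-left y (X a) (Y b)

F-YY-x : ∀ a b w → F (Y a) (Y b) (x ∷ w) ≡ 0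
F-YY-x a b w = F-step (Y a) (Y b) x w

F-YY-y : ∀ a b w → F (Y a) (Y b) (y ∷ w) ≡ lhsD a b w
F-YY-y a b w = F-step (Y a) (Y b) y w

-- Two letters x: both factors must contribute, leaving z₁z₂^a′ sh z₁z₂^b′.
lhsP-xx : ∀ a b w → lhsP a b (x ∷ x ∷ w) ≡
  atPred a (λ a′ → atPred b (λ b′ → F (Y a′) (Y b′) w)) + atPred b (λ b′ → atPred a (λ a′ → F (Y a′) (Y b′) w))
lhsP-xx a b w = trans (F-XX-x a b (x ∷ w)) (cong₂ _+_ (atPred-cong a (λ a′ → F-YX-x a′ b w)) (atPred-cong b (λ b′ → F-XY-x a b′ w)))

lhsD-x : ∀ a b w → lhsD a b (x ∷ w) ≡ atPred a (λ a′ → F (Y a′) (Y b) w) + atPred b (λ b′ → F (Y a) (Y b′) w)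
lhsD-x a b w = cong₂ _+_ (F-XY-x a b w) (F-YX-x a b w)

lhsP-xx-0 : ∀ w → (∀ a b → F (Y a) (Y b) w ≡ 0) → ∀ a b → lhsP a b (x ∷ x ∷ w) ≡ 0
lhsP-xx-0 w YY-0 a b = trans (lhsP-xx a b w)
  (cong₂ _+_ (atPred-0 a (λ a′ → atPred-0 b (YY-0 a′))) (atPred-0 b (λ b′ → atPred-0 a (λ a′ → YY-0 a′ b′))))

lhsD-x-0 : ∀ w → (∀ a b → F (Y a) (Y b) w ≡ 0) → ∀ a b → lhsD a b (x ∷ w) ≡ 0
lhsD-x-0 w YY-0 a b = trans (lhsD-x a b w) (cong₂ _+_ (atPred-0 a (λ a′ → YY-0 a′ b)) (atPred-0 b (YY-0 a)))

lhsP-nil : ∀ a b → lhsP a b [] ≡ bothZero a b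
lhsP-nil zero zero = refl
lhsP-nil zero (suc b) = refl
lhsP-nil (suc a) zero = refl
lhsP-nil (suc a) (suc b) = F-nil-left x (Y a) (X (suc b))

-- The letter z₃ = xxy: the two symmetric ways of producing it give the factor 2.
lhsP-xxy : ∀ a b w → lhsP a b (x ∷ x ∷ y ∷ w) ≡ 2 * atPred a (λ a′ → atPred b (λ b′ → lhsD a′ b′ w))
lhsP-xxy a b w = begin
  lhsP a b (x ∷ x ∷ y ∷ w)
    ≡⟨ lhsP-xx a b (y ∷ w) ⟩
  Q + atPred b (λ b′ → atPred a (λ a′ → F (Y a′) (Y b′) (y ∷ w)))
    ≡⟨ cong (Q +_) (atPred-swap a b (λ a′ b′ → F (Y a′) (Y b′) (y ∷ w))) ⟨
  Q + Q
    ≡⟨ cong (Q +_) (+-identityʳ Q) ⟨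
  2 * Q
    ≡⟨ cong (2 *_) (atPred-cong a (λ a′ → atPred-cong b (λ b′ → F-YY-y a′ b′ w))) ⟩
  2 * atPred a (λ a′ → atPred b (λ b′ → lhsD a′ b′ w)) ∎
  where
  Q : ℕ
  Q = atPred a (λ a′ → atPred b (λ b′ → F (Y a′) (Y b′) (y ∷ w)))

lhs-solves : Solves lhsP lhsD
lhs-solves a b [] = lhsP-nil a b , cong₂ _+_ (F-nil-right (X a) y (X b)) (F-nil-left y (X a) (X b))
lhs-solves a b (y ∷ w) =
  F-XX-y a b w ,
  trans (cong₂ _+_ (F-XY-y a b w) (F-YX-y a b w)) (cong (lhsP a b w +_) (sym (+-identityʳ _)))
lhs-solves a b (x ∷ []) =
  trans (F-XX-x a b []) (cong₂ _+_ (atPred-0 a (λ a′ → F-nil-left y (X a′) (X b))) (atPred-0 b (λ b′ → F-nil-right (X a) y (X b′)))) ,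
  lhsD-x-0 [] F-YY-nil a b
lhs-solves a b (x ∷ y ∷ w) =
  trans (F-XX-x a b (y ∷ w)) (cong₂ _+_ (atPred-cong a (λ a′ → F-YX-y a′ b w)) (atPred-cong b (λ b′ → F-XY-y a b′ w))) ,
  trans (lhsD-x a b (y ∷ w)) (cong₂ _+_ (atPred-cong a (λ a′ → F-YY-y a′ b w)) (atPred-cong b (λ b′ → F-YY-y a b′ w)))
lhs-solves a b (x ∷ x ∷ []) = lhsP-xx-0 [] F-YY-nil a b , lhsD-x-0 (x ∷ []) (λ a b → F-YY-x a b []) a b
lhs-solves a b (x ∷ x ∷ y ∷ w) = lhsP-xxy a b w , lhsD-x-0 (x ∷ y ∷ w) (λ a b → F-YY-x a b (y ∷ w)) a b
lhs-solves a b (x ∷ x ∷ x ∷ w) = lhsP-xx-0 (x ∷ w) (λ a b → F-YY-x a b w) a b , lhsD-x-0 (x ∷ x ∷ w) (λ a b → F-YY-x a b (x ∷ w)) a b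

zP : ℕ → ℕ → Word → ℕ
zP m k w = G (pow (2 ∷ []) m) (pow (3 ∷ 1 ∷ []) k) w

zR : ℕ → ℕ → Word → ℕ
zR m k w = G (pow (2 ∷ []) m) (1 ∷ pow (3 ∷ 1 ∷ []) k) w

zP-nil : ∀ m k → zP m k [] ≡ bothZero m k
zP-nil zero zero = refl
zP-nil zero (suc k) = refl
zP-nil (suc m) zero = refl
zP-nil (suc m) (suc k) = G-step 2 (pow (2 ∷ []) m) 3 (1 ∷ pow (3 ∷ 1 ∷ []) k) []

zP-y : ∀ m k w → zP m k (y ∷ w) ≡ 0
zP-y zero zero w = refl
zP-y zero (suc k) w = refl
zP-y (suc m) zero w = refl
zP-y (suc m) (suc k) w = G-step 2 (pow (2 ∷ []) m) 3 (1 ∷ pow (3 ∷ 1 ∷ []) k) (y ∷ w)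

zP-x : ∀ m k → zP m k (x ∷ []) ≡ 0
zP-x zero zero = refl
zP-x zero (suc k) = refl
zP-x (suc m) zero = refl
zP-x (suc m) (suc k) = G-step 2 (pow (2 ∷ []) m) 3 (1 ∷ pow (3 ∷ 1 ∷ []) k) (x ∷ [])

zP-xy : ∀ m k w → zP m k (x ∷ y ∷ w) ≡ atPred m (λ m′ → zP m′ k w)
zP-xy zero zero w = refl
zP-xy zero (suc k) w = refl
zP-xy (suc m) zero w = sym (G-right-empty (pow (2 ∷ []) m) w)
zP-xy (suc m) (suc k) w = trans (G-step 2 (pow (2 ∷ []) m) 3 (1 ∷ pow (3 ∷ 1 ∷ []) k) (x ∷ y ∷ w)) (+-identityʳ _)

zP-xx : ∀ m k → zP m k (x ∷ x ∷ []) ≡ 0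
zP-xx zero zero = refl
zP-xx zero (suc k) = refl
zP-xx (suc m) zero = refl
zP-xx (suc m) (suc k) = G-step 2 (pow (2 ∷ []) m) 3 (1 ∷ pow (3 ∷ 1 ∷ []) k) (x ∷ x ∷ [])

zP-xxy : ∀ m k w → zP m k (x ∷ x ∷ y ∷ w) ≡ atPred k (λ k′ → zR m k′ w)
zP-xxy zero zero w = refl
zP-xxy zero (suc k) w = refl
zP-xxy (suc m) zero w = refl
zP-xxy (suc m) (suc k) w = G-step 2 (pow (2 ∷ []) m) 3 (1 ∷ pow (3 ∷ 1 ∷ []) k) (x ∷ x ∷ y ∷ w)

zP-xxx : ∀ m k w → zP m k (x ∷ x ∷ x ∷ w) ≡ 0
zP-xxx zero zero w = refl
zP-xxx zero (suc k) w = refl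
zP-xxx (suc m) zero w = refl
zP-xxx (suc m) (suc k) w = G-step 2 (pow (2 ∷ []) m) 3 (1 ∷ pow (3 ∷ 1 ∷ []) k) (x ∷ x ∷ x ∷ w)

zR-nil : ∀ m k → zR m k [] ≡ 0
zR-nil zero k = refl
zR-nil (suc m) k = G-step 2 (pow (2 ∷ []) m) 1 (pow (3 ∷ 1 ∷ []) k) []

zR-y : ∀ m k w → zR m k (y ∷ w) ≡ zP m k w
zR-y zero k w = refl
zR-y (suc m) k w = G-step 2 (pow (2 ∷ []) m) 1 (pow (3 ∷ 1 ∷ []) k) (y ∷ w)

zR-x : ∀ m k → zR m k (x ∷ []) ≡ 0
zR-x zero k = refl
zR-x (suc m) k = G-step 2 (pow (2 ∷ []) m) 1 (pow (3 ∷ 1 ∷ []) k) (x ∷ [])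

zR-xy : ∀ m k w → zR m k (x ∷ y ∷ w) ≡ atPred m (λ m′ → zR m′ k w)
zR-xy zero k w = refl
zR-xy (suc m) k w = trans (G-step 2 (pow (2 ∷ []) m) 1 (pow (3 ∷ 1 ∷ []) k) (x ∷ y ∷ w)) (+-identityʳ _)

zR-xx : ∀ m k w → zR m k (x ∷ x ∷ w) ≡ 0
zR-xx zero k w = refl
zR-xx (suc m) k w = G-step 2 (pow (2 ∷ []) m) 1 (pow (3 ∷ 1 ∷ []) k) (x ∷ x ∷ w)

Σ< : ℕ → (ℕ → ℕ) → ℕ
Σ< zero f = 0
Σ< (suc K) f = f 0 + Σ< K (λ k → f (suc k))

Σ<-cong : ∀ K {f g : ℕ → ℕ} → (∀ k → k < K → f k ≡ g k) → Σ< K f ≡ Σ< K g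
Σ<-cong zero e = refl
Σ<-cong (suc K) e = cong₂ _+_ (e 0 (s≤s z≤n)) (Σ<-cong K (λ k k<K → e (suc k) (s≤s k<K)))

Σ<-+ : ∀ K (f g : ℕ → ℕ) → Σ< K (λ k → f k + g k) ≡ Σ< K f + Σ< K g
Σ<-+ zero f g = refl
Σ<-+ (suc K) f g = trans (cong ((f 0 + g 0) +_) (Σ<-+ K (λ k → f (suc k)) (λ k → g (suc k))))
                         (interchange (f 0) (g 0) _ _)

Σ<-scale : ∀ K c (f : ℕ → ℕ) → Σ< K (λ k → c * f k) ≡ c * Σ< K f
Σ<-scale zero c f = sym (*-zeroʳ c)
Σ<-scale (suc K) c f = trans (cong (c * f 0 +_) (Σ<-scale K c (λ k → f (suc k)))) (sym (*-distribˡ-+ c (f 0) _))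

Σ<-0 : ∀ K {f : ℕ → ℕ} → (∀ k → f k ≡ 0) → Σ< K f ≡ 0
Σ<-0 zero e = refl
Σ<-0 (suc K) e = cong₂ _+_ (e 0) (Σ<-0 K (λ k → e (suc k)))

Σ<-atPred : ∀ K a (t : ℕ → ℕ → ℕ) → Σ< K (λ k → atPred a (λ a′ → t a′ k)) ≡ atPred a (λ a′ → Σ< K (t a′))
Σ<-atPred K zero t = Σ<-0 K (λ k → refl)
Σ<-atPred K (suc a) t = refl

Σ<-extend : ∀ K (f : ℕ → ℕ) → f K ≡ 0 → Σ< (suc K) f ≡ Σ< K f
Σ<-extend zero f e = trans (+-identityʳ (f 0)) e
Σ<-extend (suc K) f e = cong (f 0 +_) (Σ<-extend K (λ k → f (suc k)) e)

-- cc a b k = 4^k C(a+b−2k, a−k) for k ≤ a, b and 0 otherwise; mm a b k = a+b−2k.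
-- They are defined by the recursion that makes Pascal's rule below immediate.
cc : ℕ → ℕ → ℕ → ℕ
cc a b zero = (b + a) C a
cc (suc a) (suc b) (suc k) = 4 * cc a b k
cc _ _ (suc k) = 0

mm : ℕ → ℕ → ℕ → ℕ
mm a b zero = b + a
mm (suc a) (suc b) (suc k) = mm a b k
mm _ _ (suc k) = 0

cc-beyond : ∀ a b → cc a b (suc a) ≡ 0
cc-beyond zero b = refl
cc-beyond (suc a) zero = refl
cc-beyond (suc a) (suc b) = cong (4 *_) (cc-beyond a b)

closed-exponent : ∀ a b k → suc b + suc a ∸ 2 * suc k ≡ b + a ∸ 2 * k
closed-exponent a b k rewrite +-suc b a | +-suc k (k + 0) = refl

cc-closed : ∀ k a b → k ≤ a → k ≤ b → cc a b k ≡ 4 ^ k * ((b + a ∸ 2 * k) C (a ∸ k))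
cc-closed zero a b _ _ = sym (+-identityʳ _)
cc-closed (suc k) (suc a) (suc b) (s≤s k≤a) (s≤s k≤b) = begin
  4 * cc a b k                                       ≡⟨ cong (4 *_) (cc-closed k a b k≤a k≤b) ⟩
  4 * (4 ^ k * ((b + a ∸ 2 * k) C (a ∸ k)))          ≡⟨ *-assoc 4 (4 ^ k) _ ⟨
  4 ^ suc k * ((b + a ∸ 2 * k) C (a ∸ k))            ≡⟨ cong (λ t → 4 ^ suc k * (t C (a ∸ k))) (closed-exponent a b k) ⟨
  4 ^ suc k * ((suc b + suc a ∸ 2 * suc k) C (a ∸ k)) ∎

mm-closed : ∀ k a b → k ≤ a → k ≤ b → mm a b k ≡ b + a ∸ 2 * k
mm-closed zero a b _ _ = refl
mm-closed (suc k) (suc a) (suc b) (s≤s k≤a) (s≤s k≤b) = trans (mm-closed k a b k≤a k≤b) (sym (closed-exponent a b k))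

-- Pascal's rule for the weighted terms cc · h(mm): lowering the exponent by one
-- splits according to which of a, b is lowered.
pascal : ∀ a b k (h : ℕ → ℕ) → cc a b k * atPred (mm a b k) h ≡
   atPred a (λ a′ → cc a′ b k * h (mm a′ b k)) + atPred b (λ b′ → cc a b′ k * h (mm a b′ k))
pascal zero zero zero h = refl
pascal zero (suc b) zero h = refl
pascal (suc a) zero zero h = begin
  (suc a C suc a) * h a ≡⟨ cong (_* h a) (trans (nCn≡1 (suc a)) (sym (nCn≡1 a))) ⟩
  (a C a) * h a         ≡⟨ +-identityʳ _ ⟨
  (a C a) * h a + 0     ∎
pascal (suc a) (suc b) zero h rewrite +-suc b a =
  trans (cong (_* h (suc (b + a))) (sym (nCk+nC[k+1]≡[n+1]C[k+1] (suc (b + a)) a)))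
        (*-distribʳ-+ (h (suc (b + a))) (suc (b + a) C a) (suc (b + a) C suc a))
pascal zero zero (suc k) h = refl
pascal zero (suc b) (suc k) h = refl
pascal (suc zero) zero (suc k) h = refl
pascal (suc (suc a)) zero (suc k) h = refl
pascal (suc a) (suc b) (suc k) h = begin
  4 * cc a b k * atPred (mm a b k) h
    ≡⟨ *-assoc 4 (cc a b k) _ ⟩
  4 * (cc a b k * atPred (mm a b k) h)
    ≡⟨ cong (4 *_) (pascal a b k h) ⟩
  4 * (atPred a (λ a′ → cc a′ b k * h (mm a′ b k)) + atPred b (λ b′ → cc a b′ k * h (mm a b′ k)))
    ≡⟨ *-distribˡ-+ 4 (atPred a (λ a′ → cc a′ b k * h (mm a′ b k))) (atPred b (λ b′ → cc a b′ k * h (mm a b′ k))) ⟩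
  4 * atPred a (λ a′ → cc a′ b k * h (mm a′ b k)) + 4 * atPred b (λ b′ → cc a b′ k * h (mm a b′ k))
    ≡⟨ cong₂ _+_ (raise-a a) (raise-b b) ⟩
  cc a (suc b) (suc k) * h (mm a (suc b) (suc k)) + cc (suc a) b (suc k) * h (mm (suc a) b (suc k)) ∎
  where
  -- raising both exponents by one multiplies cc by 4
  raise-a : ∀ a → 4 * atPred a (λ a′ → cc a′ b k * h (mm a′ b k)) ≡ cc a (suc b) (suc k) * h (mm a (suc b) (suc k))
  raise-a zero = refl
  raise-a (suc a) = sym (*-assoc 4 (cc a b k) _)
  raise-b : ∀ b → 4 * atPred b (λ b′ → cc a b′ k * h (mm a b′ k)) ≡ cc (suc a) b (suc k) * h (mm (suc a) b (suc k))
  raise-b zero = refl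
  raise-b (suc b) = sym (*-assoc 4 (cc a b k) _)

rhs : (ℕ → ℕ → Word → ℕ) → Family
rhs g a b w = Σ< (suc a) (λ k → cc a b k * g (mm a b k) k w)

rhsP : Family
rhsP = rhs zP

rhsD : Family
rhsD a b w = 2 * rhs zR a b w

rhs-cong : ∀ g g′ w w′ → (∀ m k → g m k w ≡ g′ m k w′) → ∀ a b → rhs g a b w ≡ rhs g′ a b w′
rhs-cong g g′ w w′ e a b = Σ<-cong (suc a) (λ k _ → cong (cc a b k *_) (e (mm a b k) k))

rhs-0 : ∀ g w → (∀ m k → g m k w ≡ 0) → ∀ a b → rhs g a b w ≡ 0
rhs-0 g w e a b = Σ<-0 (suc a) (λ k → trans (cong (cc a b k *_) (e (mm a b k) k)) (*-zeroʳ (cc a b k)))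

-- If every g reads a leading z₂ by lowering m, then so does rhs g, by lowering a or b
-- (Pascal's rule, term by term).
rhs-xy : ∀ g w → (∀ m k → g m k (x ∷ y ∷ w) ≡ atPred m (λ m′ → g m′ k w)) →
         ∀ a b → rhs g a b (x ∷ y ∷ w) ≡ atPred a (λ a′ → rhs g a′ b w) + atPred b (λ b′ → rhs g a b′ w)
rhs-xy g w g-xy a b = begin
  Σ< (suc a) (λ k → cc a b k * g (mm a b k) k (x ∷ y ∷ w))
    ≡⟨ Σ<-cong (suc a) (λ k _ → trans (cong (cc a b k *_) (g-xy (mm a b k) k)) (pascal a b k (λ m′ → g m′ k w))) ⟩
  Σ< (suc a) (λ k → atPred a (λ a′ → T a′ b k) + atPred b (λ b′ → T a b′ k))
    ≡⟨ Σ<-+ (suc a) (λ k → atPred a (λ a′ → T a′ b k)) (λ k → atPred b (λ b′ → T a b′ k)) ⟩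
  Σ< (suc a) (λ k → atPred a (λ a′ → T a′ b k)) + Σ< (suc a) (λ k → atPred b (λ b′ → T a b′ k))
    ≡⟨ cong₂ _+_ (Σ<-atPred (suc a) a (λ a′ → T a′ b)) (Σ<-atPred (suc a) b (T a)) ⟩
  atPred a (λ a′ → Σ< (suc a) (T a′ b)) + atPred b (λ b′ → rhs g a b′ w)
    ≡⟨ cong (_+ atPred b (λ b′ → rhs g a b′ w)) (shrink a) ⟩
  atPred a (λ a′ → rhs g a′ b w) + atPred b (λ b′ → rhs g a b′ w) ∎
  where
  T : ℕ → ℕ → ℕ → ℕ
  T a b k = cc a b k * g (mm a b k) k w
  -- after lowering a to a′ the term k = a′ + 1 of the sum vanishes
  shrink : ∀ a → atPred a (λ a′ → Σ< (suc a) (T a′ b)) ≡ atPred a (λ a′ → rhs g a′ b w)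
  shrink zero = refl
  shrink (suc a) = Σ<-extend (suc a) (T a b) (cong (_* g (mm a b (suc a)) (suc a) w) (cc-beyond a b))

-- Only the term k = 0, i.e. z₂^{a+b} sh~ 1, can contain the empty word.
rhsP-nil : ∀ a b → rhsP a b [] ≡ bothZero a b
rhsP-nil a b = begin
  cc a b 0 * zP (b + a) 0 [] + Σ< a (λ k → cc a b (suc k) * zP (mm a b (suc k)) (suc k) [])
    ≡⟨ cong (cc a b 0 * zP (b + a) 0 [] +_) (Σ<-0 a (λ k → trans (cong (cc a b (suc k) *_) (zP-nil (mm a b (suc k)) (suc k)))
                                                              (*-zeroʳ (cc a b (suc k))))) ⟩
  cc a b 0 * zP (b + a) 0 [] + 0
    ≡⟨ trans (+-identityʳ _) (cong (cc a b 0 *_) (zP-nil (b + a) 0)) ⟩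
  cc a b 0 * bothZero (b + a) 0
    ≡⟨ only-empty a b ⟩
  bothZero a b ∎
  where
  only-empty : ∀ a b → cc a b 0 * bothZero (b + a) 0 ≡ bothZero a b
  only-empty zero zero = refl
  only-empty zero (suc b) = *-zeroʳ (cc zero (suc b) 0)
  only-empty (suc a) zero = *-zeroʳ (cc (suc a) zero 0)
  only-empty (suc a) (suc b) = *-zeroʳ (cc (suc a) (suc b) 0)

-- A leading z₃ lowers k, and cc (a+1) (b+1) (k+1) = 4 cc a b k gives the factor 2 · 2.
rhsP-xxy : ∀ a b w → rhsP a b (x ∷ x ∷ y ∷ w) ≡ 2 * atPred a (λ a′ → atPred b (λ b′ → rhsD a′ b′ w))
rhsP-xxy a b w = begin
  rhsP a b (x ∷ x ∷ y ∷ w)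
    ≡⟨ Σ<-cong (suc a) (λ k _ → cong (cc a b k *_) (zP-xxy (mm a b k) k w)) ⟩
  cc a b 0 * 0 + Σ< a (λ k → cc a b (suc k) * zR (mm a b (suc k)) k w)
    ≡⟨ cong (_+ Σ< a (λ k → cc a b (suc k) * zR (mm a b (suc k)) k w)) (*-zeroʳ (cc a b 0)) ⟩
  Σ< a (λ k → cc a b (suc k) * zR (mm a b (suc k)) k w)
    ≡⟨ lowered a b ⟩
  2 * atPred a (λ a′ → atPred b (λ b′ → rhsD a′ b′ w)) ∎
  where
  lowered : ∀ a b → Σ< a (λ k → cc a b (suc k) * zR (mm a b (suc k)) k w) ≡ 2 * atPred a (λ a′ → atPred b (λ b′ → rhsD a′ b′ w))
  lowered zero b = refl
  lowered (suc a) zero = Σ<-0 (suc a) (λ k → refl)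
  lowered (suc a) (suc b) = begin
    Σ< (suc a) (λ k → 4 * cc a b k * zR (mm a b k) k w) ≡⟨ Σ<-cong (suc a) (λ k _ → *-assoc 4 (cc a b k) (zR (mm a b k) k w)) ⟩
    Σ< (suc a) (λ k → 4 * (cc a b k * zR (mm a b k) k w)) ≡⟨ Σ<-scale (suc a) 4 (λ k → cc a b k * zR (mm a b k) k w) ⟩
    4 * rhs zR a b w                                      ≡⟨ *-assoc 2 2 (rhs zR a b w) ⟩
    2 * rhsD a b w ∎

rhs-solves : Solves rhsP rhsD
rhs-solves a b [] = rhsP-nil a b , cong (2 *_) (rhs-0 zR [] zR-nil a b)
rhs-solves a b (y ∷ w) = rhs-0 zP (y ∷ w) (λ m k → zP-y m k w) a b , cong (2 *_) (rhs-cong zR zP (y ∷ w) w (λ m k → zR-y m k w) a b)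
rhs-solves a b (x ∷ []) = rhs-0 zP (x ∷ []) zP-x a b , cong (2 *_) (rhs-0 zR (x ∷ []) zR-x a b)
rhs-solves a b (x ∷ y ∷ w) =
  rhs-xy zP w (λ m k → zP-xy m k w) a b ,
  (begin
    2 * rhs zR a b (x ∷ y ∷ w)
      ≡⟨ cong (2 *_) (rhs-xy zR w (λ m k → zR-xy m k w) a b) ⟩
    2 * (atPred a (λ a′ → rhs zR a′ b w) + atPred b (λ b′ → rhs zR a b′ w))
      ≡⟨ *-distribˡ-+ 2 (atPred a (λ a′ → rhs zR a′ b w)) (atPred b (λ b′ → rhs zR a b′ w)) ⟩
    2 * atPred a (λ a′ → rhs zR a′ b w) + 2 * atPred b (λ b′ → rhs zR a b′ w)
      ≡⟨ cong₂ _+_ (atPred-scale 2 a (λ a′ → rhs zR a′ b w)) (atPred-scale 2 b (λ b′ → rhs zR a b′ w)) ⟩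
    atPred a (λ a′ → rhsD a′ b w) + atPred b (λ b′ → rhsD a b′ w) ∎)
rhs-solves a b (x ∷ x ∷ []) = rhs-0 zP (x ∷ x ∷ []) zP-xx a b , cong (2 *_) (rhs-0 zR (x ∷ x ∷ []) (λ m k → zR-xx m k []) a b)
rhs-solves a b (x ∷ x ∷ y ∷ w) = rhsP-xxy a b w , cong (2 *_) (rhs-0 zR (x ∷ x ∷ y ∷ w) (λ m k → zR-xx m k (y ∷ w)) a b)
rhs-solves a b (x ∷ x ∷ x ∷ w) = rhs-0 zP (x ∷ x ∷ x ∷ w) (λ m k → zP-xxx m k w) a b , cong (2 *_) (rhs-0 zR (x ∷ x ∷ x ∷ w) (λ m k → zR-xx m k (x ∷ w)) a b)

ℕ→ℚ≃ : ∀ n → ℚ.toℚᵘ (ℕ→ℚ n) ℚᵘ.≃ ℚᵘ.mkℚᵘ (ℤ.+ n) 0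
ℕ→ℚ≃ n = ℚP.toℚᵘ-fromℚᵘ (ℚᵘ.mkℚᵘ (ℤ.+ n) 0)

ℕ→ℚ-+ : ∀ m n → ℕ→ℚ (m + n) ≡ ℕ→ℚ m ℚ.+ ℕ→ℚ n
ℕ→ℚ-+ m n = ℚP.toℚᵘ-injective (ℚᵘP.≃-trans (ℕ→ℚ≃ (m + n)) (ℚᵘP.≃-sym
  (ℚᵘP.≃-trans (ℚP.toℚᵘ-homo-+ (ℕ→ℚ m) (ℕ→ℚ n)) (ℚᵘP.≃-trans (ℚᵘP.+-cong (ℕ→ℚ≃ m) (ℕ→ℚ≃ n)) sum≃))))
  where
  sum≃ : ℚᵘ.mkℚᵘ (ℤ.+ m) 0 ℚᵘ.+ ℚᵘ.mkℚᵘ (ℤ.+ n) 0 ℚᵘ.≃ ℚᵘ.mkℚᵘ (ℤ.+ (m + n)) 0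
  sum≃ = ℚᵘ.*≡* (trans (ℤP.*-identityʳ _) (trans (cong₂ ℤ._+_ (ℤP.*-identityʳ (ℤ.+ m)) (ℤP.*-identityʳ (ℤ.+ n)))
           (trans (sym (ℤP.pos-+ m n)) (sym (ℤP.*-identityʳ _)))))

ℕ→ℚ-* : ∀ m n → ℕ→ℚ (m * n) ≡ ℕ→ℚ m ℚ.* ℕ→ℚ n
ℕ→ℚ-* m n = ℚP.toℚᵘ-injective (ℚᵘP.≃-trans (ℕ→ℚ≃ (m * n)) (ℚᵘP.≃-sym
  (ℚᵘP.≃-trans (ℚP.toℚᵘ-homo-* (ℕ→ℚ m) (ℕ→ℚ n)) (ℚᵘP.≃-trans (ℚᵘP.*-cong (ℕ→ℚ≃ m) (ℕ→ℚ≃ n)) product≃))))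
  where
  product≃ : ℚᵘ.mkℚᵘ (ℤ.+ m) 0 ℚᵘ.* ℚᵘ.mkℚᵘ (ℤ.+ n) 0 ℚᵘ.≃ ℚᵘ.mkℚᵘ (ℤ.+ (m * n)) 0
  product≃ = ℚᵘ.*≡* (trans (ℤP.*-identityʳ _) (trans (sym (ℤP.pos-* m n)) (sym (ℤP.*-identityʳ _))))

coeff-++ : ∀ p q w → coeff (p ++ q) w ≡ coeff p w ℚ.+ coeff q w
coeff-++ [] q w = sym (ℚP.+-identityˡ _)
coeff-++ ((c , u) ∷ p) q w with u ≟W w
... | yes _ = trans (cong (c ℚ.+_) (coeff-++ p q w)) (sym (ℚP.+-assoc c _ _))
... | no _ = coeff-++ p q w

coeff-· : ∀ c p w → coeff (c · p) w ≡ c ℚ.* coeff p w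
coeff-· c [] w = sym (ℚP.*-zeroʳ c)
coeff-· c ((d , u) ∷ p) w with u ≟W w
... | yes _ = trans (cong (c ℚ.* d ℚ.+_) (coeff-· c p w)) (sym (ℚP.*-distribˡ-+ c d _))
... | no _ = coeff-· c p w

coeff-units : ∀ {A : Set} (f : A → Word) L w → coeff (map (λ s → (ℚ.1ℚ , f s)) L) w ≡ ℕ→ℚ (occ w (map f L))
coeff-units f [] w = refl
coeff-units f (s ∷ L) w with f s ≟W w
... | yes _ = trans (cong (ℚ.1ℚ ℚ.+_) (coeff-units f L w)) (sym (ℕ→ℚ-+ 1 (occ w (map f L))))
... | no _ = coeff-units f L w

coeff-sh : ∀ u v w → coeff (⟦ u ⟧ sh ⟦ v ⟧) w ≡ ℕ→ℚ (F u v w)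
coeff-sh u v w = begin
  coeff (⟦ u ⟧ sh ⟦ v ⟧) w
    ≡⟨ cong (λ p → coeff p w) (trans (++-identityʳ (units ++ [])) (++-identityʳ units)) ⟩
  coeff (map (λ s → (ℚ.1ℚ , s)) (shuffles u v)) w
    ≡⟨ coeff-units (λ s → s) (shuffles u v) w ⟩
  ℕ→ℚ (occ w (map (λ s → s) (shuffles u v)))
    ≡⟨ cong (λ L → ℕ→ℚ (occ w L)) (map-id (shuffles u v)) ⟩
  ℕ→ℚ (F u v w) ∎
  where
  units : Poly
  units = map (λ s → (ℚ.1ℚ , s)) (shuffles u v)

coeff-y◃-y : ∀ p w → coeff ((y ∷ []) ◃ p) (y ∷ w) ≡ coeff p w
coeff-y◃-y [] w = refl
coeff-y◃-y ((d , u) ∷ p) w with u ≟W w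
... | yes _ = cong (d ℚ.+_) (coeff-y◃-y p w)
... | no _ = coeff-y◃-y p w

coeff-y◃-x : ∀ p w → coeff ((y ∷ []) ◃ p) (x ∷ w) ≡ ℚ.0ℚ
coeff-y◃-x [] w = refl
coeff-y◃-x (_ ∷ p) w = coeff-y◃-x p w

coeff-y◃-[] : ∀ p → coeff ((y ∷ []) ◃ p) [] ≡ ℚ.0ℚ
coeff-y◃-[] [] = refl
coeff-y◃-[] (_ ∷ p) = coeff-y◃-[] p

coeff-z₁◃ : ∀ p w (f : Word → ℕ) → (∀ w′ → coeff p w′ ≡ ℕ→ℚ (f w′)) → coeff (z 1 ◃ p) w ≡ ℕ→ℚ (afterXY 0 w f)
coeff-z₁◃ p [] f e = coeff-y◃-[] p
coeff-z₁◃ p (x ∷ w) f e = coeff-y◃-x p w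
coeff-z₁◃ p (y ∷ w) f e = trans (coeff-y◃-y p w) (e w)

coeff-Σ≤ : ∀ n (c : ℕ → ℕ) (f : ℕ → Poly) (h : ℕ → ℕ) w → (∀ k → coeff (f k) w ≡ ℕ→ℚ (h k)) →
           coeff (Σ≤ n (λ k → ℕ→ℚ (c k) · f k)) w ≡ ℕ→ℚ (Σ< (suc n) (λ k → c k * h k))
coeff-Σ≤ n c f h w e = summands (suc n) (λ k → k)
  where
  term : ∀ k → coeff (ℕ→ℚ (c k) · f k) w ≡ ℕ→ℚ (c k * h k)
  term k = trans (coeff-· (ℕ→ℚ (c k)) (f k) w) (trans (cong (ℕ→ℚ (c k) ℚ.*_) (e k)) (sym (ℕ→ℚ-* (c k) (h k))))
  summands : ∀ K (s : ℕ → ℕ) → coeff (concat (map (λ k → ℕ→ℚ (c k) · f k) (applyUpTo s K))) w ≡ ℕ→ℚ (Σ< K (λ k → c (s k) * h (s k)))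
  summands zero s = refl
  summands (suc K) s = begin
    coeff ((ℕ→ℚ (c (s 0)) · f (s 0)) ++ concat (map (λ k → ℕ→ℚ (c k) · f k) (applyUpTo (λ k → s (suc k)) K))) w
      ≡⟨ coeff-++ (ℕ→ℚ (c (s 0)) · f (s 0)) _ w ⟩
    coeff (ℕ→ℚ (c (s 0)) · f (s 0)) w ℚ.+ coeff (concat (map (λ k → ℕ→ℚ (c k) · f k) (applyUpTo (λ k → s (suc k)) K))) w
      ≡⟨ cong₂ ℚ._+_ (term (s 0)) (summands K (λ k → s (suc k))) ⟩
    ℕ→ℚ (c (s 0) * h (s 0)) ℚ.+ ℕ→ℚ (Σ< K (λ k → c (s (suc k)) * h (s (suc k))))
      ≡⟨ ℕ→ℚ-+ (c (s 0) * h (s 0)) _ ⟨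
    ℕ→ℚ (Σ< (suc K) (λ k → c (s k) * h (s k))) ∎

lhs≡rhs : ∀ w a b → lhsP a b w ≡ rhsP a b w × lhsD a b w ≡ rhsD a b w
lhs≡rhs = solution-unique lhs-solves rhs-solves

binom4 : ℕ → ℕ → ℕ → ℕ
binom4 n N k = 4 ^ k * ((N + n ∸ 2 * k) C (n ∸ k))

rhs-closed : ∀ g n N → n ≤ N → ∀ w → rhs g n N w ≡ Σ< (suc n) (λ k → binom4 n N k * g (N + n ∸ 2 * k) k w)
rhs-closed g n N n≤N w = Σ<-cong (suc n) (λ k k<1+n →
  cong₂ (λ c m → c * g m k w) (cc-closed k n N (≤-pred k<1+n) (≤-trans (≤-pred k<1+n) n≤N))
                              (mm-closed k n N (≤-pred k<1+n) (≤-trans (≤-pred k<1+n) n≤N)))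

F-YY : ∀ a b w → F (Y a) (Y b) w ≡ afterXY 0 w (lhsD a b)
F-YY a b [] = F-YY-nil a b
F-YY a b (x ∷ w) = F-YY-x a b w
F-YY a b (y ∷ w) = F-YY-y a b w

afterY-linear : ∀ K c (e : ℕ → ℕ) (g : ℕ → Word → ℕ) w →
  c * Σ< K (λ k → e k * afterXY 0 w (g k)) ≡ afterXY 0 w (λ w′ → c * Σ< K (λ k → e k * g k w′))
afterY-linear K c e g [] = trans (cong (c *_) (Σ<-0 K (λ k → *-zeroʳ (e k)))) (*-zeroʳ c)
afterY-linear K c e g (x ∷ w) = trans (cong (c *_) (Σ<-0 K (λ k → *-zeroʳ (e k)))) (*-zeroʳ c)
afterY-linear K c e g (y ∷ w) = refl

identity₁ : ∀ n N → n ≤ N →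
  ⟦ pow (z 2) n ⟧ sh ⟦ pow (z 2) N ⟧ ≈ Σ≤ n (λ k → ℕ→ℚ (binom4 n N k) · (pow (2 ∷ []) (N + n ∸ 2 * k) shz pow (3 ∷ 1 ∷ []) k))
identity₁ n N n≤N w = begin
  coeff (⟦ X n ⟧ sh ⟦ X N ⟧) w
    ≡⟨ coeff-sh (X n) (X N) w ⟩
  ℕ→ℚ (lhsP n N w)
    ≡⟨ cong ℕ→ℚ (trans (proj₁ (lhs≡rhs w n N)) (rhs-closed zP n N n≤N w)) ⟩
  ℕ→ℚ (Σ< (suc n) (λ k → binom4 n N k * zP (N + n ∸ 2 * k) k w))
    ≡⟨ coeff-Σ≤ n (binom4 n N) (λ k → pow (2 ∷ []) (N + n ∸ 2 * k) shz pow (3 ∷ 1 ∷ []) k) (λ k → zP (N + n ∸ 2 * k) k w) w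
                (λ k → coeff-units toWord (shuffles (pow (2 ∷ []) (N + n ∸ 2 * k)) (pow (3 ∷ 1 ∷ []) k)) w) ⟨
  coeff (Σ≤ n (λ k → ℕ→ℚ (binom4 n N k) · (pow (2 ∷ []) (N + n ∸ 2 * k) shz pow (3 ∷ 1 ∷ []) k))) w ∎

-- The second identity: both sides are z₁ times the d-families, by the same uniqueness.
identity₂ : ∀ n N → n ≤ N →
  ⟦ z 1 ++ pow (z 2) n ⟧ sh ⟦ z 1 ++ pow (z 2) N ⟧
    ≈ ℕ→ℚ 2 · Σ≤ n (λ k → ℕ→ℚ (binom4 n N k) · (z 1 ◃ (pow (2 ∷ []) (N + n ∸ 2 * k) shz (1 ∷ pow (3 ∷ 1 ∷ []) k))))
identity₂ n N n≤N w = begin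
  coeff (⟦ Y n ⟧ sh ⟦ Y N ⟧) w
    ≡⟨ coeff-sh (Y n) (Y N) w ⟩
  ℕ→ℚ (F (Y n) (Y N) w)
    ≡⟨ cong ℕ→ℚ (F-YY n N w) ⟩
  ℕ→ℚ (afterXY 0 w (lhsD n N))
    ≡⟨ cong ℕ→ℚ (afterXY-cong w (λ w′ → trans (proj₂ (lhs≡rhs w′ n N)) (cong (2 *_) (rhs-closed zR n N n≤N w′)))) ⟩
  ℕ→ℚ (afterXY 0 w (λ w′ → 2 * Σ< (suc n) (λ k → binom4 n N k * zR (N + n ∸ 2 * k) k w′)))
    ≡⟨ cong ℕ→ℚ (afterY-linear (suc n) 2 (binom4 n N) (λ k → zR (N + n ∸ 2 * k) k) w) ⟨
  ℕ→ℚ (2 * Σ< (suc n) (λ k → binom4 n N k * afterXY 0 w (zR (N + n ∸ 2 * k) k)))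
    ≡⟨ ℕ→ℚ-* 2 (Σ< (suc n) (λ k → binom4 n N k * afterXY 0 w (zR (N + n ∸ 2 * k) k))) ⟩
  ℕ→ℚ 2 ℚ.* ℕ→ℚ (Σ< (suc n) (λ k → binom4 n N k * afterXY 0 w (zR (N + n ∸ 2 * k) k)))
    ≡⟨ cong (ℕ→ℚ 2 ℚ.*_) (coeff-Σ≤ n (binom4 n N) S (λ k → afterXY 0 w (zR (N + n ∸ 2 * k) k)) w
         (λ k → coeff-z₁◃ (T k) w (zR (N + n ∸ 2 * k) k)
                  (coeff-units toWord (shuffles (pow (2 ∷ []) (N + n ∸ 2 * k)) (1 ∷ pow (3 ∷ 1 ∷ []) k))))) ⟨
  ℕ→ℚ 2 ℚ.* coeff (Σ≤ n (λ k → ℕ→ℚ (binom4 n N k) · S k)) w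
    ≡⟨ coeff-· (ℕ→ℚ 2) (Σ≤ n (λ k → ℕ→ℚ (binom4 n N k) · S k)) w ⟨
  coeff (ℕ→ℚ 2 · Σ≤ n (λ k → ℕ→ℚ (binom4 n N k) · S k)) w ∎
  where
  T : ℕ → Poly
  T k = pow (2 ∷ []) (N + n ∸ 2 * k) shz (1 ∷ pow (3 ∷ 1 ∷ []) k)
  S : ℕ → Poly
  S k = z 1 ◃ T k
  afterXY-cong : ∀ w {f g : Word → ℕ} → (∀ w′ → f w′ ≡ g w′) → afterXY 0 w f ≡ afterXY 0 w g
  afterXY-cong [] e = refl
  afterXY-cong (x ∷ w) e = refl
  afterXY-cong (y ∷ w) e = e w

proposition2 : (n N : ℕ) → n ≤ N →
    (⟦ pow (z 2) n ⟧ sh ⟦ pow (z 2) N ⟧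
      ≈ Σ≤ n (λ k → ℕ→ℚ (4 ^ k * ((N + n ∸ 2 * k) C (n ∸ k)))
                      · (pow (2 ∷ []) (N + n ∸ 2 * k) shz pow (3 ∷ 1 ∷ []) k)))
    × (⟦ z 1 Data.List.++ pow (z 2) n ⟧ sh ⟦ z 1 Data.List.++ pow (z 2) N ⟧
      ≈ ℕ→ℚ 2 · Σ≤ n (λ k → ℕ→ℚ (4 ^ k * ((N + n ∸ 2 * k) C (n ∸ k)))
                      · (z 1 ◃ (pow (2 ∷ []) (N + n ∸ 2 * k) shz (1 ∷ pow (3 ∷ 1 ∷ []) k)))))
proposition2 n N n≤N = identity₁ n N n≤N , identity₂ n N n≤N
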